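{- Let $s\geq t\geq 2$ and $d\ge 1$ be integers. Let $H$ be a bipartite graph with parts $A$ and $M$, where $|A| = d$, every vertex of $M$ has at least $2 s^{1/(t-1)} d^{(t-2)/(t-1)}$ neighbors in $A$, and $H$ contains no copy of $K_{s,t-1}$ with the $s$ vertices in $A$ and the $t-1$ vertices in $M$. Then $H$ has at most $2td$ edges.
   Context: $K_{s,t-1}$ denotes the complete bipartite graph with parts of sizes $s$ and $t-1$. -}

module Defs where

open import Data.Nat using (ℕ; _+_)
open import Data.Bool using (Bool; if_then_else_)
open import Data.Fin using (Fin)
open import Data.List using (allFin; map)
open import Data.Nat.ListAction using (sum)
open import Data.Product using (Σ; _×_)
open import Function.Definitions using (Injective)
open import Relation.Binary.PropositionalEquality using (_≡_)
open import Data.Bool using (true)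

-- A bipartite graph with parts A = Fin d and M = Fin m, given by its
-- biadjacency relation: adj a v = true iff a ∈ A and v ∈ M are adjacent.
BipGraph : ℕ → ℕ → Set
BipGraph d m = Fin d → Fin m → Bool

degM : ∀ {d m} → BipGraph d m → Fin m → ℕ
degM {d} adj v = sum (map (λ a → if adj a v then 1 else 0) (allFin d))

edges : ∀ {d m} → BipGraph d m → ℕ
edges {d} {m} adj = sum (map (degM adj) (allFin m))

HasKsr : ∀ {d m} → BipGraph d m → ℕ → ℕ → Set
HasKsr {d} {m} adj s r =
  Σ (Fin s → Fin d) λ f → Σ (Fin r → Fin m) λ g →
    Injective _≡_ _≡_ f × Injective _≡_ _≡_ g × (∀ i j → adj (f i) (g j) ≡ true)

module Submission where

-- Kővári–Sós–Turán counting.  Let H ⊆ A × M be a bipartite graph with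
-- |A| = d, |M| = m, and put k = t-1 = j+1 and s = s'+1.  Write deg a for the
-- degree of a ∈ A, e = edges H = Σ_a deg a and Y = Σ_a (deg a ∸ j).
--
-- (1) Double counting pairs (a, S), S a k-subset of the neighbourhood of a:
--     Σ_a C(deg a, k) = Σ_S |common neighbourhood of S| ≤ s'·C(m, k),
--     because a common neighbourhood of size s would give a K_{s,k}.
-- (2) As (n ∸ j)^k ≤ k!·C(n, k) and k!·C(m, k) ≤ m^k, the power-mean
--     inequality (Σ_a y_a)^k ≤ d^j·Σ_a y_a^k turns (1) into Y^k ≤ d^j·s'·m^k;
--     moreover e ≤ Y + d·j.
-- (3) Summing the minimum-degree hypothesis over M gives m^k·2^k·s·d^j ≤ e^k.
-- (4) If e ≤ 2Y then (2) and (3) give s·e^k ≤ s'·e^k, so e = 0; otherwise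
--     e ≤ Y + d·j < e/2 + d·j, so e < 2·d·j ≤ 2·t·d.

open import Defs
open import Data.Nat using (ℕ; zero; suc; _+_; _*_; _∸_; _^_; _≤_; _<_; z≤n; s≤s; _≤?_; _!)
open import Data.Nat.Properties
open import Data.Nat.ListAction using (sum)
open import Data.Nat.Tactic.RingSolver using (solve-∀)
open import Algebra.Properties.CommutativeSemigroup +-commutativeSemigroup using (interchange)
open import Algebra.Properties.CommutativeSemigroup *-commutativeSemigroup
  using () renaming (x∙yz≈y∙xz to *-left-comm)
open import Data.Bool using (Bool; true; false; if_then_else_; T)
open import Data.Bool.Properties using (T-≡)
open import Data.Fin using (Fin; zero; suc; inject≤)
open import Data.Fin.Properties using (inject≤-injective)
open import Data.List using (List; []; _∷_; map; _++_; length; lookup; allFin; filterᵇ)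
open import Data.Bool.ListAction using (all)
open import Data.List.Properties using (length-map; length-++; length-tabulate; map-cong; filter-++)
open import Data.List.Extrema ≤-totalOrder using (argmin; f[argmin]≤f[⊤]; f[argmin]≤f[xs])
open import Data.List.Membership.Propositional using (_∈_)
open import Data.List.Membership.Propositional.Properties using (∈-lookup; ∈-++⁻; ∈-map⁻; ∈-filter⁻)
open import Data.List.Relation.Binary.Subset.Propositional using (_⊆_)
open import Data.List.Relation.Unary.All as All using (All; _∷_)
open import Data.List.Relation.Unary.All.Properties using (all⁺)
open import Data.List.Relation.Unary.Any using (here; there)
open import Data.List.Relation.Unary.Unique.Propositional using (Unique; []; _∷_)
open import Data.List.Relation.Unary.Unique.Propositional.Properties using (allFin⁺; filter⁺)
open import Data.Product using (Σ; _×_; _,_; proj₂)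
open import Data.Sum using (_⊎_; inj₁; inj₂)
open import Function using (_∘_; Equivalence)
open import Function.Definitions using (Injective)
open import Relation.Nullary using (¬_; yes; no; contradiction)
open import Relation.Nullary.Decidable using (T?)
open import Relation.Binary.PropositionalEquality
  using (_≡_; refl; sym; trans; cong; cong₂; subst; module ≡-Reasoning)

module _ {X : Set} where

  sum-map-mono : {f g : X → ℕ} (L : List X) → (∀ {x} → x ∈ L → f x ≤ g x) →
                 sum (map f L) ≤ sum (map g L)
  sum-map-mono []      f≤g = z≤n
  sum-map-mono (x ∷ L) f≤g = +-mono-≤ (f≤g (here refl)) (sum-map-mono L (f≤g ∘ there))

  sum-map-+ : (f g : X → ℕ) (L : List X) →
              sum (map (λ x → f x + g x) L) ≡ sum (map f L) + sum (map g L)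
  sum-map-+ f g []      = refl
  sum-map-+ f g (x ∷ L) =
    trans (cong (f x + g x +_) (sum-map-+ f g L))
          (interchange (f x) (g x) (sum (map f L)) (sum (map g L)))

  sum-map-*ˡ : (c : ℕ) (f : X → ℕ) (L : List X) →
               sum (map (λ x → c * f x) L) ≡ c * sum (map f L)
  sum-map-*ˡ c f []      = sym (*-zeroʳ c)
  sum-map-*ˡ c f (x ∷ L) =
    trans (cong (c * f x +_) (sum-map-*ˡ c f L)) (sym (*-distribˡ-+ c (f x) _))

  sum-map-const : (c : ℕ) (L : List X) → sum (map (λ _ → c) L) ≡ length L * c
  sum-map-const c []      = refl
  sum-map-const c (x ∷ L) = cong (c +_) (sum-map-const c L)

  sum-indicator : (p : X → Bool) (L : List X) →
                  sum (map (λ x → if p x then 1 else 0) L) ≡ length (filterᵇ p L)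
  sum-indicator p []      = refl
  sum-indicator p (x ∷ L) with p x
  ... | true  = cong suc (sum-indicator p L)
  ... | false = sum-indicator p L

sum-map-swap : {X Y : Set} (f : X → Y → ℕ) (A : List X) (B : List Y) →
  sum (map (λ x → sum (map (f x) B)) A) ≡ sum (map (λ y → sum (map (λ x → f x y) A)) B)
sum-map-swap f []      B = sym (trans (sum-map-const 0 B) (*-zeroʳ (length B)))
sum-map-swap f (a ∷ A) B =
  trans (cong (sum (map (f a) B) +_) (sum-map-swap f A B))
        (sym (sum-map-+ (f a) (λ y → sum (map (λ x → f x y) A)) B))

length-allFin : ∀ n → length (allFin n) ≡ n
length-allFin n = length-tabulate (λ i → i)

-- Binomial coefficients by Pascal's rule, and the k-element sublists of a
-- list (its k-subsets, when the list has no duplicates).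

choose : ℕ → ℕ → ℕ
choose n       zero    = 1
choose zero    (suc k) = 0
choose (suc n) (suc k) = choose n k + choose n (suc k)

sublists : {X : Set} → ℕ → List X → List (List X)
sublists zero    L       = [] ∷ []
sublists (suc k) []      = []
sublists (suc k) (x ∷ L) = map (x ∷_) (sublists k L) ++ sublists (suc k) L

module _ {X : Set} where

  length-sublists : (k : ℕ) (L : List X) → length (sublists k L) ≡ choose (length L) k
  length-sublists zero    L       = refl
  length-sublists (suc k) []      = refl
  length-sublists (suc k) (x ∷ L) = begin
    length (map (x ∷_) (sublists k L) ++ sublists (suc k) L)
      ≡⟨ length-++ (map (x ∷_) (sublists k L)) ⟩
    length (map (x ∷_) (sublists k L)) + length (sublists (suc k) L)
      ≡⟨ cong₂ _+_ (trans (length-map (x ∷_) (sublists k L)) (length-sublists k L))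
                   (length-sublists (suc k) L) ⟩
    choose (length L) k + choose (length L) (suc k) ∎
    where open ≡-Reasoning

  filter-all-prefix : (p : X → Bool) (x : X) (Z : List (List X)) →
    filterᵇ (all p) (map (x ∷_) Z) ≡ (if p x then map (x ∷_) (filterᵇ (all p) Z) else [])
  filter-all-prefix p x []      with p x
  ... | true  = refl
  ... | false = refl
  filter-all-prefix p x (S ∷ Z) with p x in px | filter-all-prefix p x Z
  ... | false | rec = rec
  ... | true  | rec with all p S
  ...   | true  = cong ((x ∷ S) ∷_) rec
  ...   | false = rec

  sublists-filter : (p : X → Bool) (k : ℕ) (L : List X) →
    sublists k (filterᵇ p L) ≡ filterᵇ (all p) (sublists k L)
  sublists-filter p zero    L       = refl
  sublists-filter p (suc k) []      = refl
  sublists-filter p (suc k) (x ∷ L)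
    rewrite filter-++ (T? ∘ all p) (map (x ∷_) (sublists k L)) (sublists (suc k) L)
          | filter-all-prefix p x (sublists k L)
    with p x
  ... | true  = cong₂ (λ Z W → map (x ∷_) Z ++ W) (sublists-filter p k L) (sublists-filter p (suc k) L)
  ... | false = sublists-filter p (suc k) L

  ∈-sublists⁻ : (k : ℕ) (x : X) (L : List X) {S : List X} → S ∈ sublists (suc k) (x ∷ L) →
    (Σ (List X) λ S′ → S′ ∈ sublists k L × S ≡ x ∷ S′) ⊎ S ∈ sublists (suc k) L
  ∈-sublists⁻ k x L S∈ with ∈-++⁻ (map (x ∷_) (sublists k L)) S∈
  ... | inj₁ S∈prefixed = inj₁ (∈-map⁻ (x ∷_) S∈prefixed)
  ... | inj₂ S∈rest     = inj₂ S∈rest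

  sublists-length : (k : ℕ) (L : List X) {S : List X} → S ∈ sublists k L → length S ≡ k
  sublists-length zero    L       (here refl) = refl
  sublists-length (suc k) (x ∷ L) S∈ with ∈-sublists⁻ k x L S∈
  ... | inj₁ (S′ , S′∈ , refl) = cong suc (sublists-length k L S′∈)
  ... | inj₂ S∈rest            = sublists-length (suc k) L S∈rest

  sublists-⊆ : (k : ℕ) (L : List X) {S : List X} → S ∈ sublists k L → S ⊆ L
  sublists-⊆ zero    L       (here refl) ()
  sublists-⊆ (suc k) (x ∷ L) S∈ with ∈-sublists⁻ k x L S∈
  ... | inj₁ (S′ , S′∈ , refl) = λ { (here refl) → here refl ; (there y∈) → there (sublists-⊆ k L S′∈ y∈) }
  ... | inj₂ S∈rest            = there ∘ sublists-⊆ (suc k) L S∈rest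

  sublists-unique : (k : ℕ) {L S : List X} → Unique L → S ∈ sublists k L → Unique S
  sublists-unique zero    _                (here refl) = []
  sublists-unique (suc k) {x ∷ L} (x∉L ∷ uL) S∈ with ∈-sublists⁻ k x L S∈
  ... | inj₁ (S′ , S′∈ , refl) =
        All.tabulate (All.lookup x∉L ∘ sublists-⊆ k L S′∈) ∷ sublists-unique k uL S′∈
  ... | inj₂ S∈rest            = sublists-unique (suc k) uL S∈rest

lookup-injective : {X : Set} {L : List X} → Unique L → ∀ i j → lookup L i ≡ lookup L j → i ≡ j
lookup-injective (_   ∷ _)  zero    zero    _  = refl
lookup-injective (x∉L ∷ _)  zero    (suc j) eq = contradiction eq (All.lookup x∉L (∈-lookup j))
lookup-injective (x∉L ∷ _)  (suc i) zero    eq = contradiction (sym eq) (All.lookup x∉L (∈-lookup i))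
lookup-injective (_   ∷ uL) (suc i) (suc j) eq = cong suc (lookup-injective uL i j eq)

injection-into : {X : Set} {L : List X} {n : ℕ} → Unique L → n ≤ length L →
  Σ (Fin n → X) λ f → Injective _≡_ _≡_ f × (∀ i → f i ∈ L)
injection-into {L = L} uL n≤ =
  (λ i → lookup L (inject≤ i n≤)) ,
  (λ eq → inject≤-injective n≤ n≤ _ _ (lookup-injective uL _ _ eq)) ,
  (λ i → ∈-lookup (inject≤ i n≤))

choose-1 : ∀ n → choose n 1 ≡ n
choose-1 zero    = refl
choose-1 (suc n) = cong suc (choose-1 n)

choose-absorb : ∀ n k → suc k * choose (suc n) (suc k) ≡ suc n * choose n k
choose-absorb zero    zero    = refl
choose-absorb zero    (suc k) = *-zeroʳ (suc (suc k))
choose-absorb (suc n) zero    = begin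
  1 * (choose (suc n) 0 + choose (suc n) 1) ≡⟨ *-identityˡ _ ⟩
  suc (choose (suc n) 1)                    ≡⟨ cong suc (choose-1 (suc n)) ⟩
  suc (suc n)                               ≡⟨ sym (*-identityʳ (suc (suc n))) ⟩
  suc (suc n) * 1                           ∎
  where open ≡-Reasoning
choose-absorb (suc n) (suc k) = begin
  suc (suc k) * (C (suc k) + choose (suc n) (suc (suc k)))
    ≡⟨ *-distribˡ-+ (suc (suc k)) (C (suc k)) _ ⟩
  suc (suc k) * C (suc k) + suc (suc k) * choose (suc n) (suc (suc k))
    ≡⟨ cong (suc (suc k) * C (suc k) +_) (choose-absorb n (suc k)) ⟩
  C (suc k) + suc k * C (suc k) + suc n * choose n (suc k)
    ≡⟨ cong (λ z → C (suc k) + z + suc n * choose n (suc k)) (choose-absorb n k) ⟩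
  C (suc k) + suc n * choose n k + suc n * choose n (suc k)
    ≡⟨ +-assoc (C (suc k)) _ _ ⟩
  C (suc k) + (suc n * choose n k + suc n * choose n (suc k))
    ≡⟨ cong (C (suc k) +_) (sym (*-distribˡ-+ (suc n) (choose n k) _)) ⟩
  C (suc k) + suc n * C (suc k) ∎
  where
  open ≡-Reasoning
  C : ℕ → ℕ
  C = choose (suc n)

-- k!·C(n, k) ≤ n^k: there are at most n^k ordered k-tuples.
choose-upper : ∀ k n → k ! * choose n k ≤ n ^ k
choose-upper zero    n       = ≤-refl
choose-upper (suc k) zero    = ≤-reflexive (*-zeroʳ (suc k !))
choose-upper (suc k) (suc n) = begin
  suc k ! * choose (suc n) (suc k)   ≡⟨ cong (_* choose (suc n) (suc k)) (*-comm (suc k) (k !)) ⟩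
  k ! * suc k * choose (suc n) (suc k) ≡⟨ *-assoc (k !) (suc k) _ ⟩
  k ! * (suc k * choose (suc n) (suc k)) ≡⟨ cong (k ! *_) (choose-absorb n k) ⟩
  k ! * (suc n * choose n k)          ≡⟨ *-left-comm (k !) (suc n) (choose n k) ⟩
  suc n * (k ! * choose n k)          ≤⟨ *-monoʳ-≤ (suc n) (choose-upper k n) ⟩
  suc n * n ^ k                       ≤⟨ *-monoʳ-≤ (suc n) (^-monoˡ-≤ k (n≤1+n n)) ⟩
  suc n * suc n ^ k                   ∎
  where open ≤-Reasoning

-- (n ∸ j)^(j+1) ≤ (j+1)!·C(n, j+1): each factor n, n-1, …, n-j of the
-- falling factorial is at least n ∸ j.
choose-lower : ∀ j n → (n ∸ j) ^ suc j ≤ suc j ! * choose n (suc j)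
choose-lower zero    n       = ≤-reflexive (trans (*-identityʳ n) (sym (trans (+-identityʳ _) (choose-1 n))))
choose-lower (suc j) zero    = z≤n
choose-lower (suc j) (suc n) = begin
  (n ∸ j) * (n ∸ j) ^ suc j             ≤⟨ *-mono-≤ (≤-trans (m∸n≤m n j) (n≤1+n n)) (choose-lower j n) ⟩
  suc n * (suc j ! * choose n (suc j))  ≡⟨ *-left-comm (suc n) (suc j !) _ ⟩
  suc j ! * (suc n * choose n (suc j))  ≡⟨ cong (suc j ! *_) (sym (choose-absorb n (suc j))) ⟩
  suc j ! * (suc (suc j) * choose (suc n) (suc (suc j))) ≡⟨ sym (*-assoc (suc j !) _ _) ⟩
  suc j ! * suc (suc j) * choose (suc n) (suc (suc j))
    ≡⟨ cong (_* choose (suc n) (suc (suc j))) (*-comm (suc j !) (suc (suc j))) ⟩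
  suc (suc j) ! * choose (suc n) (suc (suc j)) ∎
  where open ≤-Reasoning

^-distribʳ-* : ∀ a b n → (a * b) ^ n ≡ a ^ n * b ^ n
^-distribʳ-* a b zero    = refl
^-distribʳ-* a b (suc n) =
  trans (cong (a * b *_) (^-distribʳ-* a b n)) (rearrange a b (a ^ n) (b ^ n))
  where
  rearrange : ∀ a b A B → a * b * (A * B) ≡ a * A * (b * B)
  rearrange = solve-∀

-- 2cx ≤ x² + c², i.e. (x - c)² ≥ 0.
two-products≤squares : ∀ x c → 2 * c * x ≤ x * x + c * c
two-products≤squares x c with ≤-total x c
... | inj₁ x≤c = subst (λ c → 2 * c * x ≤ x * x + c * c) (m+[n∸m]≡n x≤c)
                   (subst (2 * (x + (c ∸ x)) * x ≤_) (sym (expand x (c ∸ x))) (m≤m+n _ _))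
  where
  expand : ∀ x r → x * x + (x + r) * (x + r) ≡ 2 * (x + r) * x + r * r
  expand = solve-∀
... | inj₂ c≤x = subst (λ x → 2 * c * x ≤ x * x + c * c) (m+[n∸m]≡n c≤x)
                   (subst (2 * c * (c + (x ∸ c)) ≤_) (sym (expand c (x ∸ c))) (m≤m+n _ _))
  where
  expand : ∀ c r → (c + r) * (c + r) + c * c ≡ 2 * c * (c + r) + r * r
  expand = solve-∀

am-gm : ∀ j x c → suc j * c ^ j * x ≤ x ^ suc j + j * c ^ suc j
am-gm zero    x c = ≤-reflexive (base x c)
  where
  base : ∀ x c → 1 * 1 * x ≡ x * 1 + 0 * (c * 1)
  base = solve-∀
am-gm (suc j) x c = +-cancelʳ-≤ (j * (c * P) * x) _ _ (begin
  suc (suc j) * (c * P) * x + j * (c * P) * x   ≡⟨ e₁ j c x P ⟩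
  suc j * P * (2 * c * x)                       ≤⟨ *-monoʳ-≤ (suc j * P) (two-products≤squares x c) ⟩
  suc j * P * (x * x + c * c)                   ≡⟨ e₂ j c x P ⟩
  suc j * P * x * x + suc j * (c * (c * P))     ≤⟨ +-monoˡ-≤ _ (*-monoˡ-≤ x (am-gm j x c)) ⟩
  (X + j * (c * P)) * x + suc j * (c * (c * P)) ≡⟨ e₃ j c x P X ⟩
  x * X + suc j * (c * (c * P)) + j * (c * P) * x ∎)
  where
  open ≤-Reasoning
  P = c ^ j
  X = x ^ suc j
  e₁ : ∀ j c x P → suc (suc j) * (c * P) * x + j * (c * P) * x ≡ suc j * P * (2 * c * x)
  e₁ = solve-∀
  e₂ : ∀ j c x P → suc j * P * (x * x + c * c) ≡ suc j * P * x * x + suc j * (c * (c * P))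
  e₂ = solve-∀
  e₃ : ∀ j c x P X → (X + j * (c * P)) * x + suc j * (c * (c * P))
                     ≡ x * X + suc j * (c * (c * P)) + j * (c * P) * x
  e₃ = solve-∀

-- Power-mean inequality: (Σ f)^(j+1) ≤ n^j · Σ f^(j+1) for a list of length n.
-- Apply AM–GM to each x = n·f y against c = Σ f and sum over the list.
power-mean : {X : Set} (j : ℕ) (f : X → ℕ) (L : List X) →
  sum (map f L) ^ suc j ≤ length L ^ j * sum (map (λ x → f x ^ suc j) L)
power-mean j f []          = z≤n
power-mean j f L@(_ ∷ _) = *-cancelˡ-≤ n (+-cancelʳ-≤ (n * (j * S ^ suc j)) _ _ (begin
  n * S ^ suc j + n * (j * S ^ suc j)                   ≡⟨ sym (regroup j n S (S ^ j)) ⟩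
  suc j * S ^ j * n * S                                 ≡⟨ sym (sum-map-*ˡ (suc j * S ^ j * n) f L) ⟩
  sum (map (λ x → suc j * S ^ j * n * f x) L)           ≡⟨ cong sum (map-cong (λ x → *-assoc (suc j * S ^ j) n (f x)) L) ⟩
  sum (map (λ x → suc j * S ^ j * (n * f x)) L)         ≤⟨ sum-map-mono L (λ {x} _ → am-gm j (n * f x) S) ⟩
  sum (map (λ x → (n * f x) ^ suc j + j * S ^ suc j) L) ≡⟨ sum-map-+ (λ x → (n * f x) ^ suc j) (λ _ → j * S ^ suc j) L ⟩
  sum (map (λ x → (n * f x) ^ suc j) L) + sum (map (λ _ → j * S ^ suc j) L)
    ≡⟨ cong₂ _+_ (cong sum (map-cong (λ x → ^-distribʳ-* n (f x) (suc j)) L)) (sum-map-const _ L) ⟩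
  sum (map (λ x → n ^ suc j * f x ^ suc j) L) + n * (j * S ^ suc j)
    ≡⟨ cong (_+ n * (j * S ^ suc j)) (trans (sum-map-*ˡ (n ^ suc j) (λ x → f x ^ suc j) L) (*-assoc n (n ^ j) _)) ⟩
  n * (n ^ j * sum (map (λ x → f x ^ suc j) L)) + n * (j * S ^ suc j) ∎))
  where
  open ≤-Reasoning
  n = length L
  S = sum (map f L)
  regroup : ∀ j n S Q → suc j * Q * n * S ≡ n * (S * Q) + n * (j * (S * Q))
  regroup = solve-∀

-- If Q ≤ (f x)^(k+1) for every x, then n^(k+1)·Q ≤ (Σ f)^(k+1) for a list of
-- length n: the sum is at least n times the value at a minimiser of f.
sum-power-lower : {X : Set} (k Q : ℕ) (f : X → ℕ) (L : List X) →
  (∀ x → Q ≤ f x ^ suc k) → length L ^ suc k * Q ≤ sum (map f L) ^ suc k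
sum-power-lower k Q f []        _      = z≤n
sum-power-lower k Q f L@(x ∷ L′) Q≤f^ = begin
  n ^ suc k * Q             ≤⟨ *-monoʳ-≤ (n ^ suc k) (Q≤f^ x₀) ⟩
  n ^ suc k * f x₀ ^ suc k  ≡⟨ sym (^-distribʳ-* n (f x₀) (suc k)) ⟩
  (n * f x₀) ^ suc k        ≤⟨ ^-monoˡ-≤ (suc k) n·min≤sum ⟩
  sum (map f L) ^ suc k     ∎
  where
  open ≤-Reasoning
  n = length L
  x₀ = argmin f x L′
  minimal : ∀ {y} → y ∈ L → f x₀ ≤ f y
  minimal (here refl) = f[argmin]≤f[⊤] {f = f} x L′
  minimal (there y∈)  = All.lookup (f[argmin]≤f[xs] {f = f} x L′) y∈
  n·min≤sum : n * f x₀ ≤ sum (map f L)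
  n·min≤sum = begin
    n * f x₀                  ≡⟨ sym (sum-map-const (f x₀) L) ⟩
    sum (map (λ _ → f x₀) L)  ≤⟨ sum-map-mono L minimal ⟩
    sum (map f L)             ∎

module Counting {d m : ℕ} (H : BipGraph d m) where

  nbhd : Fin d → List (Fin m)
  nbhd a = filterᵇ (H a) (allFin m)

  degA : Fin d → ℕ
  degA a = length (nbhd a)

  common : List (Fin m) → List (Fin d)
  common S = filterᵇ (λ a → all (H a) S) (allFin d)

  edges≡sum-degA : edges H ≡ sum (map degA (allFin d))
  edges≡sum-degA =
    trans (sym (sum-map-swap (λ a v → if H a v then 1 else 0) (allFin d) (allFin m)))
          (cong sum (map-cong (λ a → sum-indicator (H a) (allFin m)) (allFin d)))

  -- Double counting the pairs (a, S) with S a k-subset of nbhd a: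
  -- Σ_a C(deg a, k) = Σ_{S ⊆ M, |S| = k} |common S|.
  sum-choose-degA : ∀ k → sum (map (λ a → choose (degA a) k) (allFin d))
                        ≡ sum (map (length ∘ common) (sublists k (allFin m)))
  sum-choose-degA k = begin
    sum (map (λ a → choose (degA a) k) (allFin d))
      ≡⟨ cong sum (map-cong pairs-at-a (allFin d)) ⟩
    sum (map (λ a → sum (map (λ S → if all (H a) S then 1 else 0) Subsets)) (allFin d))
      ≡⟨ sum-map-swap (λ a S → if all (H a) S then 1 else 0) (allFin d) Subsets ⟩
    sum (map (λ S → sum (map (λ a → if all (H a) S then 1 else 0) (allFin d))) Subsets)
      ≡⟨ cong sum (map-cong (λ S → sum-indicator (λ a → all (H a) S) (allFin d)) Subsets) ⟩
    sum (map (length ∘ common) Subsets) ∎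
    where
    open ≡-Reasoning
    Subsets = sublists k (allFin m)
    pairs-at-a : ∀ a → choose (degA a) k ≡ sum (map (λ S → if all (H a) S then 1 else 0) Subsets)
    pairs-at-a a = begin
      choose (degA a) k                           ≡⟨ sym (length-sublists k (nbhd a)) ⟩
      length (sublists k (nbhd a))                ≡⟨ cong length (sublists-filter (H a) k (allFin m)) ⟩
      length (filterᵇ (all (H a)) Subsets)        ≡⟨ sym (sum-indicator (all (H a)) Subsets) ⟩
      sum (map (λ S → if all (H a) S then 1 else 0) Subsets) ∎

  common-small : ∀ {s′ k S} → ¬ HasKsr H (suc s′) k → S ∈ sublists k (allFin m) →
                 length (common S) ≤ s′
  common-small {s′} {k} {S} K-free S∈ with length (common S) ≤? s′
  ... | yes small = small
  ... | no  large
    with injection-into (filter⁺ (T? ∘ λ a → all (H a) S) (allFin⁺ d)) (≰⇒> large)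
       | injection-into (sublists-unique k (allFin⁺ m) S∈)
                        (≤-reflexive (sym (sublists-length k (allFin m) S∈)))
  ... | f , f-inj , f∈common | g , g-inj , g∈S =
        contradiction (f , g , (λ {_ _} → f-inj) , (λ {_ _} → g-inj) , adjacent) K-free
    where
    adjacent : ∀ i j → H (f i) (g j) ≡ true
    adjacent i j = Equivalence.to T-≡ (All.lookup (all⁺ (H (f i)) S adjacent-to-S) (g∈S j))
      where
      adjacent-to-S : T (all (H (f i)) S)
      adjacent-to-S = proj₂ (∈-filter⁻ (T? ∘ λ a → all (H a) S) {xs = allFin d} (f∈common i))

  excess : ℕ → ℕ
  excess j = sum (map (λ a → degA a ∸ j) (allFin d))

  excess-power-sum : ∀ {s′} j → ¬ HasKsr H (suc s′) (suc j) →
    sum (map (λ a → (degA a ∸ j) ^ suc j) (allFin d)) ≤ s′ * m ^ suc j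
  excess-power-sum {s′} j K-free = begin
    sum (map (λ a → (degA a ∸ j) ^ k) (allFin d))
      ≤⟨ sum-map-mono (allFin d) (λ {a} _ → choose-lower j (degA a)) ⟩
    sum (map (λ a → k ! * choose (degA a) k) (allFin d))
      ≡⟨ sum-map-*ˡ (k !) (λ a → choose (degA a) k) (allFin d) ⟩
    k ! * sum (map (λ a → choose (degA a) k) (allFin d))
      ≡⟨ cong (k ! *_) (sum-choose-degA k) ⟩
    k ! * sum (map (length ∘ common) Subsets)
      ≤⟨ *-monoʳ-≤ (k !) (sum-map-mono Subsets (common-small K-free)) ⟩
    k ! * sum (map (λ _ → s′) Subsets)
      ≡⟨ cong (k ! *_) (sum-map-const s′ Subsets) ⟩
    k ! * (length Subsets * s′)
      ≡⟨ cong (λ n → k ! * (n * s′)) (trans (length-sublists k (allFin m)) (cong (λ n → choose n k) (length-allFin m))) ⟩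
    k ! * (choose m k * s′)
      ≡⟨ sym (*-assoc (k !) (choose m k) s′) ⟩
    k ! * choose m k * s′
      ≤⟨ *-monoˡ-≤ s′ (choose-upper k m) ⟩
    m ^ k * s′
      ≡⟨ *-comm (m ^ k) s′ ⟩
    s′ * m ^ k ∎
    where
    open ≤-Reasoning
    k = suc j
    Subsets = sublists k (allFin m)

  excess-bound : ∀ {s′} j → ¬ HasKsr H (suc s′) (suc j) →
    excess j ^ suc j ≤ d ^ j * (s′ * m ^ suc j)
  excess-bound {s′} j K-free = begin
    excess j ^ suc j
      ≤⟨ power-mean j (λ a → degA a ∸ j) (allFin d) ⟩
    length (allFin d) ^ j * sum (map (λ a → (degA a ∸ j) ^ suc j) (allFin d))
      ≡⟨ cong (λ n → n ^ j * sum (map (λ a → (degA a ∸ j) ^ suc j) (allFin d))) (length-allFin d) ⟩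
    d ^ j * sum (map (λ a → (degA a ∸ j) ^ suc j) (allFin d))
      ≤⟨ *-monoʳ-≤ (d ^ j) (excess-power-sum j K-free) ⟩
    d ^ j * (s′ * m ^ suc j) ∎
    where open ≤-Reasoning

  edges≤excess : ∀ j → edges H ≤ d * j + excess j
  edges≤excess j = begin
    edges H                                          ≡⟨ edges≡sum-degA ⟩
    sum (map degA (allFin d))                        ≤⟨ sum-map-mono (allFin d) (λ {a} _ → m≤n+m∸n (degA a) j) ⟩
    sum (map (λ a → j + (degA a ∸ j)) (allFin d))    ≡⟨ sum-map-+ (λ _ → j) (λ a → degA a ∸ j) (allFin d) ⟩
    sum (map (λ _ → j) (allFin d)) + excess j        ≡⟨ cong (_+ excess j) (sum-map-const j (allFin d)) ⟩
    length (allFin d) * j + excess j                 ≡⟨ cong (λ n → n * j + excess j) (length-allFin d) ⟩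
    d * j + excess j                                 ∎
    where open ≤-Reasoning

-- If e ≤ 2Y, then (s'+1)·e^k ≤ 2^k·(s'+1)·Y^k ≤ 2^k·(s'+1)·d^j·s'·m^k ≤ s'·e^k,
-- which forces e = 0.
no-edges-if-excess-large : ∀ j s′ d m e Y →
  Y ^ suc j ≤ d ^ j * (s′ * m ^ suc j) →
  m ^ suc j * (2 ^ suc j * suc s′ * d ^ j) ≤ e ^ suc j →
  e ≤ 2 * Y → e ≡ 0
no-edges-if-excess-large j s′ d m e Y Y-bound e-lower e≤2Y =
  m^n≡0⇒m≡0 e (suc j) (n≤0⇒n≡0 (+-cancelʳ-≤ (s′ * e ^ suc j) (e ^ suc j) 0 sandwich))
  where
  open ≤-Reasoning
  regroup : ∀ s′ T D M → suc s′ * (T * (D * (s′ * M))) ≡ s′ * (M * (T * suc s′ * D))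
  regroup = solve-∀
  sandwich : suc s′ * e ^ suc j ≤ s′ * e ^ suc j
  sandwich = begin
    suc s′ * e ^ suc j                                 ≤⟨ *-monoʳ-≤ (suc s′) (^-monoˡ-≤ (suc j) e≤2Y) ⟩
    suc s′ * (2 * Y) ^ suc j                           ≡⟨ cong (suc s′ *_) (^-distribʳ-* 2 Y (suc j)) ⟩
    suc s′ * (2 ^ suc j * Y ^ suc j)                   ≤⟨ *-monoʳ-≤ (suc s′) (*-monoʳ-≤ (2 ^ suc j) Y-bound) ⟩
    suc s′ * (2 ^ suc j * (d ^ j * (s′ * m ^ suc j)))  ≡⟨ regroup s′ (2 ^ suc j) (d ^ j) (m ^ suc j) ⟩
    s′ * (m ^ suc j * (2 ^ suc j * suc s′ * d ^ j))    ≤⟨ *-monoʳ-≤ s′ e-lower ⟩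
    s′ * e ^ suc j                                     ∎

-- If 2Y < e, then 2e ≤ 2·d·j + 2Y < 2·d·j + e, so e < 2·d·j.
few-edges-if-excess-small : ∀ d j e Y → e ≤ d * j + Y → 2 * Y < e → e < 2 * (d * j)
few-edges-if-excess-small d j e Y e≤ 2Y<e = +-cancelˡ-< e e (2 * (d * j)) (begin-strict
  e + e                   ≡⟨ cong (e +_) (sym (+-identityʳ e)) ⟩
  2 * e                   ≤⟨ *-monoʳ-≤ 2 e≤ ⟩
  2 * (d * j + Y)         ≡⟨ *-distribˡ-+ 2 (d * j) Y ⟩
  2 * (d * j) + 2 * Y     <⟨ +-monoʳ-< (2 * (d * j)) 2Y<e ⟩
  2 * (d * j) + e         ≡⟨ +-comm (2 * (d * j)) e ⟩
  e + 2 * (d * j)         ∎)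
  where open ≤-Reasoning

edge-bound : ∀ j s′ d m e Y →
  Y ^ suc j ≤ d ^ j * (s′ * m ^ suc j) →
  e ≤ d * j + Y →
  m ^ suc j * (2 ^ suc j * suc s′ * d ^ j) ≤ e ^ suc j →
  e ≤ 2 * suc (suc j) * d
edge-bound j s′ d m e Y Y-bound e≤ e-lower with e ≤? 2 * Y
... | yes e≤2Y = subst (_≤ 2 * suc (suc j) * d)
                   (sym (no-edges-if-excess-large j s′ d m e Y Y-bound e-lower e≤2Y)) z≤n
... | no  e≰2Y = begin
  e                        ≤⟨ <⇒≤ (few-edges-if-excess-small d j e Y e≤ (≰⇒> e≰2Y)) ⟩
  2 * (d * j)              ≤⟨ m≤m+n (2 * (d * j)) (4 * d) ⟩
  2 * (d * j) + 4 * d      ≡⟨ expand j d ⟩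
  2 * suc (suc j) * d      ∎
  where
  open ≤-Reasoning
  expand : ∀ j d → 2 * (d * j) + 4 * d ≡ 2 * suc (suc j) * d
  expand = solve-∀

lemma3p3 : (s t d m : ℕ) → t ≤ s → 2 ≤ t → 1 ≤ d → (H : BipGraph d m)
    → (∀ v → 2 ^ (t ∸ 1) * s * d ^ (t ∸ 2) ≤ degM H v ^ (t ∸ 1))
    → ¬ HasKsr H s (t ∸ 1)
    → edges H ≤ 2 * t * d
lemma3p3 zero     (suc (suc j)) d m ()  _         _ H min-degree K-free
lemma3p3 s        (suc zero)    d m _   (s≤s ())  _ H min-degree K-free
lemma3p3 (suc s′) (suc (suc j)) d m _   _         _ H min-degree K-free =
  edge-bound j s′ d m (edges H) (excess j) (excess-bound j K-free) (edges≤excess j) edges-lower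
  where
  open Counting H
  -- Summing the minimum-degree hypothesis over the m vertices of M.
  edges-lower : m ^ suc j * (2 ^ suc j * suc s′ * d ^ j) ≤ edges H ^ suc j
  edges-lower = subst (λ n → n ^ suc j * (2 ^ suc j * suc s′ * d ^ j) ≤ edges H ^ suc j)
                      (length-allFin m)
                      (sum-power-lower j _ (degM H) (allFin m) min-degree)
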